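{- Let $G$ be a $K_{2,3}$-saturated graph with vertex set $V$ and let $\alpha \in V$. Let $V_1 = N[\alpha] \cup \{ v \in V : |N(v) \cap N(\alpha)| = 2\}$, $\mathcal{U}_2 = \{ v \in V \setminus V_1 : |N(v) \cap N(\alpha)| = 1\}$, and $\mathcal{U}_3 = V \setminus (V_1 \cup \mathcal{U}_2)$. For $b \in \mathcal{U}_2$ define $\omega(b) = |N(b) \cap V_1| + 0.5\,|N(b) \cap \mathcal{U}_2|$. Let $x^* \in N(\alpha)$ with $|N(x^*) \cap N(\alpha)| \leq 1$. If $y \in \mathcal{U}_2$ and $x^*$ is the unique common neighbor of $\alpha$ and $y$, then $\omega(y) \geq 1.5$, and if $\omega(y) = 1.5$, then there exist $x \in N(\alpha) \cap N(x^*)$ and $y' \in N(x)$ such that $N(y) \cap \mathcal{U}_2 = \{y'\}$. Moreover, if $z \in \mathcal{U}_3$, then $$|N(z) \cap (V \setminus \mathcal{U}_3)| \geq 1 + |\{ x \in N(\alpha) : N(z) \cap N(x) \cap \mathcal{U}_2 \neq \emptyset \}|.$$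
   Context: All graphs are finite and simple; $N(x)$ is the set of neighbors of $x$ and $N[x] = N(x) \cup \{x\}$. A graph $G$ is $K_{2,3}$-saturated if it contains no subgraph isomorphic to $K_{2,3}$, but adding any edge between two nonadjacent vertices creates a subgraph isomorphic to $K_{2,3}$. -}

module Defs where

open import Data.Nat using (ℕ; _+_; _*_; _≡ᵇ_)
open import Data.Bool using (Bool; true; false; _∧_; _∨_; not; if_then_else_)
open import Data.Fin using (Fin; _≟_)
open import Data.List using (List; allFin; map)
open import Data.Nat.ListAction using (sum)
open import Data.Bool.ListAction using (any)
open import Data.Product using (Σ; ∃; _×_; _,_)
open import Relation.Binary.PropositionalEquality using (_≡_; _≢_)
open import Relation.Nullary using (¬_)
open import Relation.Nullary.Decidable using (⌊_⌋)

record Graph (n : ℕ) : Set where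
  field
    adj    : Fin n → Fin n → Bool
    sym    : ∀ u v → adj u v ≡ adj v u
    irrefl : ∀ v → adj v v ≡ false
open Graph public

VSet : ℕ → Set
VSet n = Fin n → Bool

card : ∀ {n} → VSet n → ℕ
card {n} S = sum (map (λ v → if S v then 1 else 0) (allFin n))

_∩_ : ∀ {n} → VSet n → VSet n → VSet n
(S ∩ T) v = S v ∧ T v

compl : ∀ {n} → VSet n → VSet n
compl S v = not (S v)

nonempty : ∀ {n} → VSet n → Bool
nonempty {n} S = any S (allFin n)

N : ∀ {n} → Graph n → Fin n → VSet n
N G x v = adj G x v

N[_,_] : ∀ {n} → Graph n → Fin n → VSet n
N[ G , x ] v = ⌊ v ≟ x ⌋ ∨ adj G x v

ContainsK23 : ∀ {n} → (Fin n → Fin n → Bool) → Set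
ContainsK23 {n} E =
  Σ (Fin n) λ a₁ → Σ (Fin n) λ a₂ → Σ (Fin n) λ b₁ → Σ (Fin n) λ b₂ → Σ (Fin n) λ b₃ →
    (a₁ ≢ a₂ × a₁ ≢ b₁ × a₁ ≢ b₂ × a₁ ≢ b₃ × a₂ ≢ b₁ × a₂ ≢ b₂ × a₂ ≢ b₃ ×
     b₁ ≢ b₂ × b₁ ≢ b₃ × b₂ ≢ b₃) ×
    (E a₁ b₁ ≡ true × E a₁ b₂ ≡ true × E a₁ b₃ ≡ true ×
     E a₂ b₁ ≡ true × E a₂ b₂ ≡ true × E a₂ b₃ ≡ true)

addEdge : ∀ {n} → (Fin n → Fin n → Bool) → Fin n → Fin n → (Fin n → Fin n → Bool)
addEdge E u v x y = E x y ∨ ((⌊ x ≟ u ⌋ ∧ ⌊ y ≟ v ⌋) ∨ (⌊ x ≟ v ⌋ ∧ ⌊ y ≟ u ⌋))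

K23Saturated : ∀ {n} → Graph n → Set
K23Saturated {n} G =
  ¬ ContainsK23 (adj G) ×
  (∀ (u v : Fin n) → u ≢ v → adj G u v ≡ false → ContainsK23 (addEdge (adj G) u v))

module _ {n : ℕ} (G : Graph n) (α : Fin n) where
  cα : Fin n → ℕ
  cα v = card (N G v ∩ N G α)

  V₁ : VSet n
  V₁ v = N[ G , α ] v ∨ (cα v ≡ᵇ 2)

  U₂ : VSet n
  U₂ v = not (V₁ v) ∧ (cα v ≡ᵇ 1)

  U₃ : VSet n
  U₃ v = not (V₁ v ∨ U₂ v)

  -- twice the weight ω(b) = |N(b) ∩ V₁| + 0.5 |N(b) ∩ U₂|
  ω2 : Fin n → ℕ
  ω2 b = 2 * card (N G b ∩ V₁) + card (N G b ∩ U₂)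

-- Everything rests on saturation: for v ∉ V₁, adding αv creates a K₂,₃ through
-- the new edge, so G contains a K₂,₃ minus the edge αv. If α lies on its side of
-- size two, the other vertex there has two common neighbours with α and so lies
-- in V₁; otherwise v has two neighbours joined to one x ∈ N(α), and since
-- K₂,₃-freeness caps common neighbourhoods at two, both lie in V₁ ∪ U₂.
-- For y ∈ U₂ this yields, besides x*, either a second V₁-neighbour or
-- U₂-neighbours, whence the weight bound. For z ∈ U₃ it yields a neighbour
-- outside U₃ missed by the map sending each x linked to z to a linking U₂-vertex;
-- that map is injective since a vertex of U₂ has a single neighbour in N(α).
module Submission where

open import Defs hiding (sym)
open import Data.Nat using (ℕ; zero; suc; _+_; _≤_; _≤?_; z≤n; s≤s; _≡ᵇ_)
open import Data.Nat.Properties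
  using (≤-trans; ≤-antisym; ≤-pred; ≰⇒>; 1+n≰n; +-suc; +-mono-≤; *-monoʳ-≤; m≤m+n;
         suc-injective; ≡ᵇ⇒≡; ≤-reflexive; n≤1+n; module ≤-Reasoning)
open import Data.Bool using (Bool; true; false; _∧_; _∨_; not; if_then_else_; T)
open import Data.Bool.Properties using (∧-conicalˡ; ∧-conicalʳ; ∨-conicalˡ; ∧-identityʳ; ∨-zeroʳ; T-≡)
open import Data.Fin using (Fin; zero; suc; _≟_)
open import Data.List using (allFin)
open import Data.List.Properties using (map-cong; map-tabulate)
open import Data.List.Relation.Unary.Any using (satisfied)
open import Data.List.Relation.Unary.Any.Properties using (any⁻)
open import Data.Nat.ListAction using (sum)
open import Data.Product using (Σ; ∃; _×_; _,_; proj₁; proj₂)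
open import Data.Sum using (_⊎_; inj₁; inj₂)
open import Data.Empty using (⊥-elim)
open import Data.Unit using (tt)
open import Function using (_∘_; id; case_of_; Equivalence)
open import Relation.Binary.PropositionalEquality
  using (_≡_; _≢_; refl; sym; trans; cong; cong₂; subst; module ≡-Reasoning)
open import Relation.Nullary using (¬_; yes; no)
open import Relation.Nullary.Decidable using (⌊_⌋; ⌊⌋-map′)

∧-elim : ∀ {x y} → x ∧ y ≡ true → x ≡ true × y ≡ true
∧-elim {x} {y} p = ∧-conicalˡ x y p , ∧-conicalʳ x y p

∧-intro : ∀ {x y} → x ≡ true → y ≡ true → x ∧ y ≡ true
∧-intro refl refl = refl

∨-elim : ∀ {x y} → x ∨ y ≡ true → x ≡ true ⊎ y ≡ true
∨-elim {true}  _ = inj₁ refl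
∨-elim {false} p = inj₂ p

∨-introˡ : ∀ {x y} → x ≡ true → x ∨ y ≡ true
∨-introˡ refl = refl

∨-introʳ : ∀ {x y} → y ≡ true → x ∨ y ≡ true
∨-introʳ {x} refl = ∨-zeroʳ x

not-true : ∀ {x} → not x ≡ true → x ≡ false
not-true {false} refl = refl

true≢false : true ≢ false
true≢false ()

bool-cases : ∀ {p} {P : Set p} (b : Bool) → (b ≡ false → P) → (b ≡ true → P) → P
bool-cases false f _ = f refl
bool-cases true  _ t = t refl

≟-true : ∀ {n} {x y : Fin n} → ⌊ x ≟ y ⌋ ≡ true → x ≡ y
≟-true {x = x} {y} p with x ≟ y
... | yes x≡y = x≡y

≡ᵇ-true : ∀ {m n} → (m ≡ᵇ n) ≡ true → m ≡ n
≡ᵇ-true {m} {n} p = ≡ᵇ⇒≡ m n (subst T (sym p) tt)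

indicator : Bool → ℕ
indicator b = if b then 1 else 0

card-suc : ∀ {n} (S : VSet (suc n)) → card S ≡ indicator (S zero) + card (S ∘ suc)
card-suc S = cong (indicator (S zero) +_) (cong sum
  (trans (map-tabulate suc (indicator ∘ S)) (sym (map-tabulate id (indicator ∘ S ∘ suc)))))

card-cong : ∀ {n} {S T : VSet n} → (∀ v → S v ≡ T v) → card S ≡ card T
card-cong {n} S≗T = cong sum (map-cong (cong indicator ∘ S≗T) (allFin n))

infixl 6 _∖_
_∖_ : ∀ {n} → VSet n → Fin n → VSet n
(S ∖ v) w = S w ∧ not ⌊ w ≟ v ⌋

module _ {n : ℕ} (S : VSet n) (v : Fin n) {w : Fin n} where

  ∖-⊆ : (S ∖ v) w ≡ true → S w ≡ true
  ∖-⊆ = proj₁ ∘ ∧-elim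

  ∖-≢ : (S ∖ v) w ≡ true → w ≢ v
  ∖-≢ p w≡v with w ≟ v
  ... | yes _ = true≢false (sym (proj₂ (∧-elim p)))
  ... | no w≢v = w≢v w≡v

  ∈-∖ : S w ≡ true → w ≢ v → (S ∖ v) w ≡ true
  ∈-∖ Sw w≢v with w ≟ v
  ... | yes w≡v = ⊥-elim (w≢v w≡v)
  ... | no _ = ∧-intro Sw refl

card-∖ : ∀ {n} (S : VSet n) {v} → S v ≡ true → card S ≡ suc (card (S ∖ v))
card-∖ {suc n} S {zero} Sv rewrite card-suc S | card-suc (S ∖ zero) | Sv =
  cong suc (card-cong λ w → sym (∧-identityʳ (S (suc w))))
card-∖ {suc n} S {suc v} Sv = begin
  card S                                            ≡⟨ card-suc S ⟩
  indicator (S zero) + card (S ∘ suc)               ≡⟨ cong (indicator (S zero) +_) (card-∖ (S ∘ suc) Sv) ⟩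
  indicator (S zero) + suc (card ((S ∘ suc) ∖ v))   ≡⟨ +-suc _ _ ⟩
  suc (indicator (S zero) + card ((S ∘ suc) ∖ v))   ≡⟨ cong suc (cong₂ _+_ head-kept (card-cong tail-∖)) ⟩
  suc (indicator ((S ∖ suc v) zero) + card ((S ∖ suc v) ∘ suc)) ≡⟨ cong suc (sym (card-suc (S ∖ suc v))) ⟩
  suc (card (S ∖ suc v))                            ∎
  where
  open ≡-Reasoning
  head-kept : indicator (S zero) ≡ indicator ((S ∖ suc v) zero)
  head-kept = cong indicator (sym (∧-identityʳ (S zero)))
  tail-∖ : ∀ w → ((S ∘ suc) ∖ v) w ≡ ((S ∖ suc v) ∘ suc) w
  tail-∖ w = cong (λ b → S (suc w) ∧ not b) (sym (⌊⌋-map′ _ _ (w ≟ v)))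

member⇒1≤card : ∀ {n} (S : VSet n) {v} → S v ≡ true → 1 ≤ card S
member⇒1≤card S Sv rewrite card-∖ S Sv = s≤s z≤n

module _ {n : ℕ} (S : VSet n) where

  members⇒2≤card : ∀ {u v} → S u ≡ true → S v ≡ true → u ≢ v → 2 ≤ card S
  members⇒2≤card Su Sv u≢v rewrite card-∖ S Su = s≤s (member⇒1≤card (S ∖ _) (∈-∖ S _ Sv (u≢v ∘ sym)))

  card≤1⇒unique : ∀ {u v} → card S ≤ 1 → S u ≡ true → S v ≡ true → u ≡ v
  card≤1⇒unique {u} {v} card≤1 Su Sv with u ≟ v
  ... | yes u≡v = u≡v
  ... | no u≢v = ⊥-elim (1+n≰n (≤-trans (members⇒2≤card Su Sv u≢v) card≤1))

  nonempty⇒member : nonempty S ≡ true → ∃ λ v → S v ≡ true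
  nonempty⇒member p with v , Sv ← satisfied (any⁻ S (allFin n) (Equivalence.from T-≡ p)) =
    v , Equivalence.to T-≡ Sv

1≤card⇒member : ∀ {n} (S : VSet n) → 1 ≤ card S → ∃ λ v → S v ≡ true
1≤card⇒member {suc n} S 1≤card rewrite card-suc S with S zero in S0
... | true  = zero , S0
... | false with v , Sv ← 1≤card⇒member (S ∘ suc) 1≤card = suc v , Sv

suc≤card⇒member : ∀ {n k} (S : VSet n) → suc k ≤ card S → ∃ λ v → S v ≡ true × k ≤ card (S ∖ v)
suc≤card⇒member S k<card with v , Sv ← 1≤card⇒member S (≤-trans (s≤s z≤n) k<card) =
  v , Sv , ≤-pred (subst (_ ≤_) (card-∖ S Sv) k<card)

3≤card⇒members : ∀ {n} (S : VSet n) → 3 ≤ card S →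
  Σ (Fin n) λ a → Σ (Fin n) λ b → Σ (Fin n) λ c →
    S a ≡ true × S b ≡ true × S c ≡ true × a ≢ b × a ≢ c × b ≢ c
3≤card⇒members S 3≤card
  with a , Sa , 2≤card₁ ← suc≤card⇒member S 3≤card
  with b , S₁b , 1≤card₂ ← suc≤card⇒member (S ∖ a) 2≤card₁
  with c , S₂c ← 1≤card⇒member (S ∖ a ∖ b) 1≤card₂ =
  a , b , c , Sa , ∖-⊆ S a S₁b , ∖-⊆ S a (∖-⊆ (S ∖ a) b S₂c) ,
  ∖-≢ S a S₁b ∘ sym , ∖-≢ S a (∖-⊆ (S ∖ a) b S₂c) ∘ sym , ∖-≢ (S ∖ a) b S₂c ∘ sym

module _ {n : ℕ} (R : Fin n → Fin n → Set) (R-injective : ∀ {s s′ t} → R s t → R s′ t → s ≡ s′) where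

  card-≤-injection : ∀ (S T : VSet n) →
    (∀ {s} → S s ≡ true → ∃ λ t → T t ≡ true × R s t) → card S ≤ card T
  card-≤-injection S T = go (card S) S T refl
    where
    go : ∀ k (S T : VSet n) → card S ≡ k →
      (∀ {s} → S s ≡ true → ∃ λ t → T t ≡ true × R s t) → card S ≤ card T
    go zero S T card≡0 _ rewrite card≡0 = z≤n
    go (suc k) S T card≡1+k into
      with s , Ss ← 1≤card⇒member S (subst (1 ≤_) (sym card≡1+k) (s≤s z≤n))
      with t , Tt , Rst ← into Ss = begin
        card S             ≡⟨ card-∖ S Ss ⟩
        suc (card (S ∖ s)) ≤⟨ s≤s (go k (S ∖ s) (T ∖ t) (suc-injective (trans (sym (card-∖ S Ss)) card≡1+k)) into′) ⟩
        suc (card (T ∖ t)) ≡⟨ sym (card-∖ T Tt) ⟩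
        card T             ∎
      where
      open ≤-Reasoning
      into′ : ∀ {s′} → (S ∖ s) s′ ≡ true → ∃ λ t′ → (T ∖ t) t′ ≡ true × R s′ t′
      into′ S′s′ with t′ , Tt′ , Rs′t′ ← into (∖-⊆ S s S′s′) =
        t′ , ∈-∖ T t Tt′ (λ { refl → ∖-≢ S s S′s′ (R-injective Rs′t′ Rst) }) , Rs′t′

SamePair : ∀ {n} → Fin n → Fin n → Fin n → Fin n → Set
SamePair x y u v = (x ≡ u × y ≡ v) ⊎ (x ≡ v × y ≡ u)

module _ {n : ℕ} (E : Fin n → Fin n → Bool) (u v : Fin n) where

  addEdge-edge : ∀ {x y} → addEdge E u v x y ≡ true → E x y ≡ true ⊎ SamePair x y u v
  addEdge-edge p with ∨-elim p
  ... | inj₁ Exy = inj₁ Exy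
  ... | inj₂ new with ∨-elim new
  ... | inj₁ xu∧yv = let xu , yv = ∧-elim xu∧yv in inj₂ (inj₁ (≟-true xu , ≟-true yv))
  ... | inj₂ xv∧yu = let xv , yu = ∧-elim xv∧yu in inj₂ (inj₂ (≟-true xv , ≟-true yu))

  addEdge-avoiding : ∀ {w x y} → w ≡ u ⊎ w ≡ v → addEdge E u v x y ≡ true → x ≢ w → y ≢ w → E x y ≡ true
  addEdge-avoiding w∈uv p x≢w y≢w with addEdge-edge p | w∈uv
  ... | inj₁ Exy                | _        = Exy
  ... | inj₂ (inj₁ (refl , _))  | inj₁ refl = ⊥-elim (x≢w refl)
  ... | inj₂ (inj₁ (_ , refl))  | inj₂ refl = ⊥-elim (y≢w refl)
  ... | inj₂ (inj₂ (refl , _))  | inj₂ refl = ⊥-elim (x≢w refl)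
  ... | inj₂ (inj₂ (_ , refl))  | inj₁ refl = ⊥-elim (y≢w refl)

module _ {n : ℕ} {E : Fin n → Fin n → Bool} where

  swap-a : ContainsK23 E → ContainsK23 E
  swap-a (a₁ , a₂ , b₁ , b₂ , b₃ , (d₁ , d₂ , d₃ , d₄ , d₅ , d₆ , d₇ , d₈ , d₉ , d₁₀) , (e₁ , e₂ , e₃ , e₄ , e₅ , e₆)) =
    a₂ , a₁ , b₁ , b₂ , b₃ , (d₁ ∘ sym , d₅ , d₆ , d₇ , d₂ , d₃ , d₄ , d₈ , d₉ , d₁₀) , (e₄ , e₅ , e₆ , e₁ , e₂ , e₃)

  swap-b₁b₂ : ContainsK23 E → ContainsK23 E
  swap-b₁b₂ (a₁ , a₂ , b₁ , b₂ , b₃ , (d₁ , d₂ , d₃ , d₄ , d₅ , d₆ , d₇ , d₈ , d₉ , d₁₀) , (e₁ , e₂ , e₃ , e₄ , e₅ , e₆)) =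
    a₁ , a₂ , b₂ , b₁ , b₃ , (d₁ , d₃ , d₂ , d₄ , d₆ , d₅ , d₇ , d₈ ∘ sym , d₁₀ , d₉) , (e₂ , e₁ , e₃ , e₅ , e₄ , e₆)

  swap-b₁b₃ : ContainsK23 E → ContainsK23 E
  swap-b₁b₃ (a₁ , a₂ , b₁ , b₂ , b₃ , (d₁ , d₂ , d₃ , d₄ , d₅ , d₆ , d₇ , d₈ , d₉ , d₁₀) , (e₁ , e₂ , e₃ , e₄ , e₅ , e₆)) =
    a₁ , a₂ , b₃ , b₂ , b₁ , (d₁ , d₄ , d₃ , d₂ , d₇ , d₆ , d₅ , d₁₀ ∘ sym , d₉ ∘ sym , d₈ ∘ sym) , (e₃ , e₂ , e₁ , e₆ , e₅ , e₄)

module _ {n : ℕ} (G : Graph n) where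

  adj-sym : ∀ {u v} → adj G u v ≡ true → adj G v u ≡ true
  adj-sym {u} {v} u~v = trans (Graph.sym G v u) u~v

  adj⇒≢ : ∀ {u v} → adj G u v ≡ true → u ≢ v
  adj⇒≢ {u} u~u refl = true≢false (trans (sym u~u) (irrefl G u))

  common-neighbours≤2 : ¬ ContainsK23 (adj G) → ∀ {u v} → u ≢ v → card (N G u ∩ N G v) ≤ 2
  common-neighbours≤2 K23-free {u} {v} u≢v with card (N G u ∩ N G v) ≤? 2
  ... | yes ≤2 = ≤2
  ... | no ≰2 with a , b , c , a∈ , b∈ , c∈ , a≢b , a≢c , b≢c ← 3≤card⇒members (N G u ∩ N G v) (≰⇒> ≰2) =
    let u~a , v~a = ∧-elim a∈ ; u~b , v~b = ∧-elim b∈ ; u~c , v~c = ∧-elim c∈ in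
    ⊥-elim (K23-free (u , v , a , b , c ,
      (u≢v , adj⇒≢ u~a , adj⇒≢ u~b , adj⇒≢ u~c , adj⇒≢ v~a , adj⇒≢ v~b , adj⇒≢ v~c , a≢b , a≢c , b≢c) ,
      (u~a , u~b , u~c , v~a , v~b , v~c)))

  -- A copy of K₂,₃ from which only the edge uv is missing, with u on the side of size two.
  record K23MinusEdge (u v : Fin n) : Set where
    field
      partner leaf₁ leaf₂ : Fin n
      leaf₁≢leaf₂ : leaf₁ ≢ leaf₂
      u~leaf₁ : adj G u leaf₁ ≡ true
      u~leaf₂ : adj G u leaf₂ ≡ true
      partner~v : adj G partner v ≡ true
      partner~leaf₁ : adj G partner leaf₁ ≡ true
      partner~leaf₂ : adj G partner leaf₂ ≡ true

    2≤common-partner : 2 ≤ card (N G partner ∩ N G u)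
    2≤common-partner = members⇒2≤card (N G partner ∩ N G u)
      (∧-intro partner~leaf₁ u~leaf₁) (∧-intro partner~leaf₂ u~leaf₂) leaf₁≢leaf₂

  module _ (u v : Fin n) where

    private
      E′ = addEdge (adj G) u v

    -- The edges a₁bⱼ (j ≠ 1) avoid b₁ and the edges at a₂ avoid a₁; as a₁, b₁ ∈ {u, v}, none is uv.
    K23-at-uv⇒K23MinusEdge : (K : ContainsK23 E′) → let (a₁ , _ , b₁ , _) = K in
      a₁ ≡ u ⊎ a₁ ≡ v → b₁ ≡ u ⊎ b₁ ≡ v → K23MinusEdge a₁ b₁
    K23-at-uv⇒K23MinusEdge (a₁ , a₂ , b₁ , b₂ , b₃ ,
        (a₁≢a₂ , a₁≢b₁ , a₁≢b₂ , a₁≢b₃ , _ , _ , _ , b₁≢b₂ , b₁≢b₃ , b₂≢b₃) ,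
        (_ , a₁b₂ , a₁b₃ , a₂b₁ , a₂b₂ , a₂b₃)) a₁∈uv b₁∈uv = record
      { partner = a₂ ; leaf₁ = b₂ ; leaf₂ = b₃ ; leaf₁≢leaf₂ = b₂≢b₃
      ; u~leaf₁ = addEdge-avoiding (adj G) u v b₁∈uv a₁b₂ a₁≢b₁ (b₁≢b₂ ∘ sym)
      ; u~leaf₂ = addEdge-avoiding (adj G) u v b₁∈uv a₁b₃ a₁≢b₁ (b₁≢b₃ ∘ sym)
      ; partner~v = addEdge-avoiding (adj G) u v a₁∈uv a₂b₁ (a₁≢a₂ ∘ sym) (a₁≢b₁ ∘ sym)
      ; partner~leaf₁ = addEdge-avoiding (adj G) u v a₁∈uv a₂b₂ (a₁≢a₂ ∘ sym) (a₁≢b₂ ∘ sym)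
      ; partner~leaf₂ = addEdge-avoiding (adj G) u v a₁∈uv a₂b₃ (a₁≢a₂ ∘ sym) (a₁≢b₃ ∘ sym)
      }

    new-edge⇒K23MinusEdge : (K : ContainsK23 E′) → let (a₁ , _ , b₁ , _) = K in
      adj G a₁ b₁ ≡ false → K23MinusEdge u v ⊎ K23MinusEdge v u
    new-edge⇒K23MinusEdge K@(_ , _ , _ , _ , _ , _ , (a₁b₁ , _)) a₁≁b₁
      with addEdge-edge (adj G) u v a₁b₁
    ... | inj₁ a₁~b₁ = ⊥-elim (true≢false (trans (sym a₁~b₁) a₁≁b₁))
    ... | inj₂ (inj₁ (refl , refl)) = inj₁ (K23-at-uv⇒K23MinusEdge K (inj₁ refl) (inj₂ refl))
    ... | inj₂ (inj₂ (refl , refl)) = inj₂ (K23-at-uv⇒K23MinusEdge K (inj₂ refl) (inj₁ refl))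

  -- Adding uv creates a K₂,₃; one of its six edges is missing from G, and by
  -- symmetry of K₂,₃ it can be moved to the position a₁b₁.
  saturated⇒K23MinusEdge : K23Saturated G → ∀ {u v} → u ≢ v → adj G u v ≡ false →
    K23MinusEdge u v ⊎ K23MinusEdge v u
  saturated⇒K23MinusEdge (K23-free , saturated) {u} {v} u≢v u≁v
    with K@(a₁ , a₂ , b₁ , b₂ , b₃ , distinct , _) ← saturated u v u≢v u≁v =
    bool-cases (adj G a₁ b₁) (new K) λ e₁ →
    bool-cases (adj G a₁ b₂) (new (swap-b₁b₂ K)) λ e₂ →
    bool-cases (adj G a₁ b₃) (new (swap-b₁b₃ K)) λ e₃ →
    bool-cases (adj G a₂ b₁) (new (swap-a K)) λ e₄ →
    bool-cases (adj G a₂ b₂) (new (swap-b₁b₂ (swap-a K))) λ e₅ →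
    bool-cases (adj G a₂ b₃) (new (swap-b₁b₃ (swap-a K))) λ e₆ →
    ⊥-elim (K23-free (a₁ , a₂ , b₁ , b₂ , b₃ , distinct , (e₁ , e₂ , e₃ , e₄ , e₅ , e₆)))
    where new = new-edge⇒K23MinusEdge u v

module Partition {n : ℕ} (G : Graph n) (saturated : K23Saturated G) (α : Fin n) where

  open K23MinusEdge

  private
    K23-free : ¬ ContainsK23 (adj G)
    K23-free = proj₁ saturated

  adj-α⇒V₁ : ∀ {v} → adj G α v ≡ true → V₁ G α v ≡ true
  adj-α⇒V₁ {v} α~v = ∨-introˡ (∨-introʳ {⌊ v ≟ α ⌋} α~v)

  2≤cα⇒V₁ : ∀ {v} → 2 ≤ cα G α v → V₁ G α v ≡ true
  2≤cα⇒V₁ {v} 2≤c with v ≟ α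
  ... | yes _ = refl
  ... | no v≢α with adj G α v
  ... | true = refl
  ... | false rewrite ≤-antisym (common-neighbours≤2 G K23-free v≢α) 2≤c = refl

  1≤cα⇒V₁⊎U₂ : ∀ {v} → 1 ≤ cα G α v → V₁ G α v ≡ true ⊎ U₂ G α v ≡ true
  1≤cα⇒V₁⊎U₂ {v} 1≤c with v ≟ α
  ... | yes _ = inj₁ refl
  ... | no v≢α with adj G α v
  ... | true = inj₁ refl
  ... | false with cα G α v | 1≤c | common-neighbours≤2 G K23-free v≢α
  ... | 1 | _ | _ = inj₂ refl
  ... | 2 | _ | _ = inj₁ refl
  ... | suc (suc (suc _)) | _ | s≤s (s≤s ())

  ∉V₁⇒≢α×≁α : ∀ {v} → V₁ G α v ≡ false → v ≢ α × adj G α v ≡ false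
  ∉V₁⇒≢α×≁α {v} v∉V₁ with v ≟ α | adj G α v | v∉V₁
  ... | no v≢α | false | _ = v≢α , refl

  U₂⇒∉V₁ : ∀ {v} → U₂ G α v ≡ true → V₁ G α v ≡ false
  U₂⇒∉V₁ = not-true ∘ proj₁ ∘ ∧-elim

  U₂⇒cα≡1 : ∀ {v} → U₂ G α v ≡ true → cα G α v ≡ 1
  U₂⇒cα≡1 = ≡ᵇ-true ∘ proj₂ ∘ ∧-elim

  U₃⇒∉V₁ : ∀ {v} → U₃ G α v ≡ true → V₁ G α v ≡ false
  U₃⇒∉V₁ = ∨-conicalˡ _ _ ∘ not-true

  V₁⇒∉U₃ : ∀ {v} → V₁ G α v ≡ true → compl (U₃ G α) v ≡ true
  V₁⇒∉U₃ v∈V₁ rewrite v∈V₁ = refl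

  U₂⇒∉U₃ : ∀ {v} → U₂ G α v ≡ true → compl (U₃ G α) v ≡ true
  U₂⇒∉U₃ {v} v∈U₂ rewrite v∈U₂ | ∨-zeroʳ (V₁ G α v) = refl

  neighbour-of-N-α⇒V₁⊎U₂ : ∀ {x v} → adj G α x ≡ true → adj G x v ≡ true →
    V₁ G α v ≡ true ⊎ U₂ G α v ≡ true
  neighbour-of-N-α⇒V₁⊎U₂ {v = v} α~x x~v =
    1≤cα⇒V₁⊎U₂ (member⇒1≤card (N G v ∩ N G α) (∧-intro (adj-sym G x~v) α~x))

  U₂-common-neighbour-unique : ∀ {t x x′} → U₂ G α t ≡ true →
    adj G α x ≡ true → adj G x t ≡ true → adj G α x′ ≡ true → adj G x′ t ≡ true → x ≡ x′
  U₂-common-neighbour-unique {t} t∈U₂ α~x x~t α~x′ x′~t =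
    card≤1⇒unique (N G t ∩ N G α) (≤-reflexive (U₂⇒cα≡1 t∈U₂)) (∧-intro (adj-sym G x~t) α~x) (∧-intro (adj-sym G x′~t) α~x′)

  partner-in-V₁ : ∀ {v} → (M : K23MinusEdge G α v) → V₁ G α (partner M) ≡ true
  partner-in-V₁ M = 2≤cα⇒V₁ (2≤common-partner M)

  partner-neighbour⇒V₁⊎U₂ : ∀ {v b} (M : K23MinusEdge G v α) → adj G (partner M) b ≡ true →
    V₁ G α b ≡ true ⊎ U₂ G α b ≡ true
  partner-neighbour⇒V₁⊎U₂ M = neighbour-of-N-α⇒V₁⊎U₂ (adj-sym G (partner~v M))

  ∉V₁⇒K23MinusEdge : ∀ {v} → V₁ G α v ≡ false → K23MinusEdge G α v ⊎ K23MinusEdge G v α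
  ∉V₁⇒K23MinusEdge v∉V₁ = let v≢α , α≁v = ∉V₁⇒≢α×≁α v∉V₁ in
    saturated⇒K23MinusEdge G saturated (v≢α ∘ sym) α≁v

  LowWeightShape : Fin n → Fin n → Set
  LowWeightShape x* y = Σ (Fin n) λ x → Σ (Fin n) λ y′ →
    adj G α x ≡ true × adj G x* x ≡ true × adj G x y′ ≡ true ×
    (∀ (v : Fin n) → ((adj G y v ∧ U₂ G α v) ≡ true → v ≡ y′) × (v ≡ y′ → (adj G y v ∧ U₂ G α v) ≡ true))

  WeightBound : Fin n → Fin n → Set
  WeightBound x* y = 3 ≤ ω2 G α y × (ω2 G α y ≡ 3 → LowWeightShape x* y)

  module _ {y : Fin n} where

    two-V₁-neighbours⇒4≤ω2 : ∀ {a b} → a ≢ b → adj G y a ≡ true → adj G y b ≡ true →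
      V₁ G α a ≡ true → V₁ G α b ≡ true → 4 ≤ ω2 G α y
    two-V₁-neighbours⇒4≤ω2 a≢b y~a y~b a∈V₁ b∈V₁ = ≤-trans
      (*-monoʳ-≤ 2 (members⇒2≤card (N G y ∩ V₁ G α) (∧-intro y~a a∈V₁) (∧-intro y~b b∈V₁) a≢b))
      (m≤m+n _ _)

    V₁-and-two-U₂-neighbours⇒4≤ω2 : ∀ {a b b′} → adj G y a ≡ true → V₁ G α a ≡ true →
      b ≢ b′ → adj G y b ≡ true → adj G y b′ ≡ true → U₂ G α b ≡ true → U₂ G α b′ ≡ true →
      4 ≤ ω2 G α y
    V₁-and-two-U₂-neighbours⇒4≤ω2 y~a a∈V₁ b≢b′ y~b y~b′ b∈U₂ b′∈U₂ = +-mono-≤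
      (*-monoʳ-≤ 2 (member⇒1≤card (N G y ∩ V₁ G α) (∧-intro y~a a∈V₁)))
      (members⇒2≤card (N G y ∩ U₂ G α) (∧-intro y~b b∈U₂) (∧-intro y~b′ b′∈U₂) b≢b′)

    4≤ω2⇒WeightBound : ∀ {x*} → 4 ≤ ω2 G α y → WeightBound x* y
    4≤ω2⇒WeightBound 4≤ω = ≤-trans (n≤1+n 3) 4≤ω , λ ω≡3 → ⊥-elim (1+n≰n (subst (4 ≤_) ω≡3 4≤ω))

    V₁-and-U₂-neighbours⇒WeightBound : ∀ {a x* x y′} → adj G y a ≡ true → V₁ G α a ≡ true →
      adj G y y′ ≡ true → U₂ G α y′ ≡ true →
      adj G α x ≡ true → adj G x* x ≡ true → adj G x y′ ≡ true → WeightBound x* y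
    V₁-and-U₂-neighbours⇒WeightBound {x = x} {y′} y~a a∈V₁ y~y′ y′∈U₂ α~x x*~x x~y′ =
      +-mono-≤ (*-monoʳ-≤ 2 1≤V₁-part) (member⇒1≤card (N G y ∩ U₂ G α) y′∈NU₂) ,
      λ ω≡3 → x , y′ , α~x , x*~x , x~y′ , λ v →
        (λ v∈NU₂ → card≤1⇒unique (N G y ∩ U₂ G α) (U₂-part≤1 ω≡3) v∈NU₂ y′∈NU₂) , λ { refl → y′∈NU₂ }
      where
      y′∈NU₂ : (N G y ∩ U₂ G α) y′ ≡ true
      y′∈NU₂ = ∧-intro y~y′ y′∈U₂
      1≤V₁-part : 1 ≤ card (N G y ∩ V₁ G α)
      1≤V₁-part = member⇒1≤card (N G y ∩ V₁ G α) (∧-intro y~a a∈V₁)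
      U₂-part≤1 : ω2 G α y ≡ 3 → card (N G y ∩ U₂ G α) ≤ 1
      U₂-part≤1 ω≡3 with card (N G y ∩ U₂ G α) ≤? 1
      ... | yes ≤1 = ≤1
      ... | no ≰1 = ⊥-elim (1+n≰n (subst (4 ≤_) ω≡3 (+-mono-≤ (*-monoʳ-≤ 2 1≤V₁-part) (≰⇒> ≰1))))

  module _ {x* y} (α~x* : adj G α x* ≡ true) (y~x* : adj G y x* ≡ true) where

    private
      x*∈V₁ : V₁ G α x* ≡ true
      x*∈V₁ = adj-α⇒V₁ α~x*

      V₁-neighbour : ∀ {b} → b ≢ x* → adj G y b ≡ true → V₁ G α b ≡ true → WeightBound x* y
      V₁-neighbour b≢x* y~b b∈V₁ =
        4≤ω2⇒WeightBound (two-V₁-neighbours⇒4≤ω2 (b≢x* ∘ sym) y~x* y~b x*∈V₁ b∈V₁)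

    weight-bound-via-partner : card (N G x* ∩ N G α) ≤ 1 → K23MinusEdge G α y → WeightBound x* y
    weight-bound-via-partner x*-sparse M = V₁-neighbour partner≢x* (adj-sym G (partner~v M)) (partner-in-V₁ M)
      where
      partner≢x* : partner M ≢ x*
      partner≢x* refl = 1+n≰n (≤-trans (2≤common-partner M) x*-sparse)

    module _ (M : K23MinusEdge G y α) where

      private
        other-leaf : ∀ {b} → b ≢ x* → adj G y b ≡ true → adj G (partner M) b ≡ true →
          adj G (partner M) x* ≡ true → WeightBound x* y
        other-leaf b≢x* y~b p~b p~x* with partner-neighbour⇒V₁⊎U₂ M p~b
        ... | inj₁ b∈V₁ = V₁-neighbour b≢x* y~b b∈V₁
        ... | inj₂ b∈U₂ = V₁-and-U₂-neighbours⇒WeightBound y~x* x*∈V₁ y~b b∈U₂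
                            (adj-sym G (partner~v M)) (adj-sym G p~x*) p~b

      weight-bound-via-leaves : WeightBound x* y
      weight-bound-via-leaves with leaf₁ M ≟ x* | leaf₂ M ≟ x*
      ... | yes refl | _ = other-leaf (leaf₁≢leaf₂ M ∘ sym) (u~leaf₂ M) (partner~leaf₂ M) (partner~leaf₁ M)
      ... | no _ | yes refl = other-leaf (leaf₁≢leaf₂ M) (u~leaf₁ M) (partner~leaf₁ M) (partner~leaf₂ M)
      ... | no leaf₁≢x* | no leaf₂≢x*
            with partner-neighbour⇒V₁⊎U₂ M (partner~leaf₁ M) | partner-neighbour⇒V₁⊎U₂ M (partner~leaf₂ M)
      ...   | inj₁ leaf₁∈V₁ | _ = V₁-neighbour leaf₁≢x* (u~leaf₁ M) leaf₁∈V₁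
      ...   | _ | inj₁ leaf₂∈V₁ = V₁-neighbour leaf₂≢x* (u~leaf₂ M) leaf₂∈V₁
      ...   | inj₂ leaf₁∈U₂ | inj₂ leaf₂∈U₂ = 4≤ω2⇒WeightBound (V₁-and-two-U₂-neighbours⇒4≤ω2
              y~x* x*∈V₁ (leaf₁≢leaf₂ M) (u~leaf₁ M) (u~leaf₂ M) leaf₁∈U₂ leaf₂∈U₂)

  weight-bound : ∀ {x* y} → adj G α x* ≡ true → card (N G x* ∩ N G α) ≤ 1 →
    U₂ G α y ≡ true → adj G y x* ≡ true → WeightBound x* y
  weight-bound α~x* x*-sparse y∈U₂ y~x* with ∉V₁⇒K23MinusEdge (U₂⇒∉V₁ y∈U₂)
  ... | inj₁ M = weight-bound-via-partner α~x* y~x* x*-sparse M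
  ... | inj₂ M = weight-bound-via-leaves α~x* y~x* M

  links-to-U₂ : Fin n → VSet n
  links-to-U₂ z x = adj G α x ∧ nonempty (N G z ∩ (N G x ∩ U₂ G α))

  module _ {z : Fin n} where

    links-to-U₂⇒witness : ∀ {x} → links-to-U₂ z x ≡ true →
      ∃ λ t → adj G z t ≡ true × U₂ G α t ≡ true × adj G x t ≡ true
    links-to-U₂⇒witness {x} x∈links with t , t∈ ← nonempty⇒member _ (proj₂ (∧-elim x∈links)) =
      let z~t , x~t∧t∈U₂ = ∧-elim t∈ ; x~t , t∈U₂ = ∧-elim x~t∧t∈U₂ in t , z~t , t∈U₂ , x~t

    links-with-spare⇒bound : ∀ {w₀} → adj G z w₀ ≡ true → compl (U₃ G α) w₀ ≡ true →
      (∀ {x} → links-to-U₂ z x ≡ true →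
        ∃ λ t → adj G z t ≡ true × U₂ G α t ≡ true × adj G x t ≡ true × t ≢ w₀) →
      1 + card (links-to-U₂ z) ≤ card (N G z ∩ compl (U₃ G α))
    links-with-spare⇒bound {w₀} z~w₀ w₀∉U₃ link = begin
      1 + card (links-to-U₂ z)            ≤⟨ s≤s (card-≤-injection Link Link-injective _ _ into) ⟩
      1 + card (Nz∖U₃ ∖ w₀)               ≡⟨ sym (card-∖ Nz∖U₃ (∧-intro z~w₀ w₀∉U₃)) ⟩
      card Nz∖U₃                          ∎
      where
      open ≤-Reasoning
      Nz∖U₃ : VSet n
      Nz∖U₃ = N G z ∩ compl (U₃ G α)
      Link : Fin n → Fin n → Set
      Link x t = adj G α x ≡ true × adj G x t ≡ true × U₂ G α t ≡ true
      Link-injective : ∀ {x x′ t} → Link x t → Link x′ t → x ≡ x′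
      Link-injective (α~x , x~t , t∈U₂) (α~x′ , x′~t , _) = U₂-common-neighbour-unique t∈U₂ α~x x~t α~x′ x′~t
      into : ∀ {x} → links-to-U₂ z x ≡ true → ∃ λ t → (Nz∖U₃ ∖ w₀) t ≡ true × Link x t
      into x∈links with t , z~t , t∈U₂ , x~t , t≢w₀ ← link x∈links =
        t , ∈-∖ Nz∖U₃ w₀ (∧-intro z~t (U₂⇒∉U₃ t∈U₂)) t≢w₀ , proj₁ (∧-elim x∈links) , x~t , t∈U₂

    V₁-neighbour⇒bound : ∀ {w₀} → adj G z w₀ ≡ true → V₁ G α w₀ ≡ true →
      1 + card (links-to-U₂ z) ≤ card (N G z ∩ compl (U₃ G α))
    V₁-neighbour⇒bound z~w₀ w₀∈V₁ = links-with-spare⇒bound z~w₀ (V₁⇒∉U₃ w₀∈V₁) λ x∈links →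
      let t , z~t , t∈U₂ , x~t = links-to-U₂⇒witness x∈links in
      t , z~t , t∈U₂ , x~t , λ { refl → true≢false (trans (sym w₀∈V₁) (U₂⇒∉V₁ t∈U₂)) }

    -- With both leaves in U₂, leaf₂ is the spare vertex: the only x linked
    -- through leaf₂ is the partner, which is also linked through leaf₁.
    neighbourhood-bound-via-leaves : K23MinusEdge G z α →
      1 + card (links-to-U₂ z) ≤ card (N G z ∩ compl (U₃ G α))
    neighbourhood-bound-via-leaves M
      with partner-neighbour⇒V₁⊎U₂ M (partner~leaf₁ M) | partner-neighbour⇒V₁⊎U₂ M (partner~leaf₂ M)
    ... | inj₁ leaf₁∈V₁ | _ = V₁-neighbour⇒bound (u~leaf₁ M) leaf₁∈V₁
    ... | _ | inj₁ leaf₂∈V₁ = V₁-neighbour⇒bound (u~leaf₂ M) leaf₂∈V₁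
    ... | inj₂ leaf₁∈U₂ | inj₂ leaf₂∈U₂ =
      links-with-spare⇒bound (u~leaf₂ M) (U₂⇒∉U₃ leaf₂∈U₂) λ {x} x∈links →
        let t , z~t , t∈U₂ , x~t = links-to-U₂⇒witness x∈links in
        case t ≟ leaf₂ M of λ where
          (no t≢leaf₂) → t , z~t , t∈U₂ , x~t , t≢leaf₂
          (yes refl) → leaf₁ M , u~leaf₁ M , leaf₁∈U₂ ,
            subst (λ p → adj G p (leaf₁ M) ≡ true)
              (U₂-common-neighbour-unique leaf₂∈U₂
                (adj-sym G (partner~v M)) (partner~leaf₂ M) (proj₁ (∧-elim x∈links)) x~t)
              (partner~leaf₁ M) ,
            leaf₁≢leaf₂ M

  U₃-neighbourhood-bound : ∀ {z} → U₃ G α z ≡ true →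
    1 + card (links-to-U₂ z) ≤ card (N G z ∩ compl (U₃ G α))
  U₃-neighbourhood-bound z∈U₃ with ∉V₁⇒K23MinusEdge (U₃⇒∉V₁ z∈U₃)
  ... | inj₁ M = V₁-neighbour⇒bound (adj-sym G (partner~v M)) (partner-in-V₁ M)
  ... | inj₂ M = neighbourhood-bound-via-leaves M

corollary3p3 : ∀ {n : ℕ} (G : Graph n) → K23Saturated G →
    (α x* : Fin n) → adj G α x* ≡ true → card (N G x* ∩ N G α) ≤ 1 →
    (∀ (y : Fin n) → U₂ G α y ≡ true →
      (∀ (v : Fin n) → ((adj G α v ∧ adj G y v) ≡ true → v ≡ x*) × (v ≡ x* → (adj G α v ∧ adj G y v) ≡ true)) →
      (3 ≤ ω2 G α y) ×
      (ω2 G α y ≡ 3 →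
        Σ (Fin n) λ x → Σ (Fin n) λ y′ →
          adj G α x ≡ true × adj G x* x ≡ true × adj G x y′ ≡ true ×
          (∀ (v : Fin n) → ((adj G y v ∧ U₂ G α v) ≡ true → v ≡ y′) × (v ≡ y′ → (adj G y v ∧ U₂ G α v) ≡ true)))) ×
    (∀ (z : Fin n) → U₃ G α z ≡ true →
      1 + card (λ x → adj G α x ∧ nonempty (N G z ∩ (N G x ∩ U₂ G α))) ≤ card (N G z ∩ compl (U₃ G α)))
corollary3p3 G saturated α x* α~x* x*-sparse =
  (λ y y∈U₂ x*-unique → weight-bound α~x* x*-sparse y∈U₂ (proj₂ (∧-elim (proj₂ (x*-unique x*) refl)))) ,
  (λ z z∈U₃ → U₃-neighbourhood-bound z∈U₃)
  where open Partition G saturated α
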